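{- Let $\ell\ge0$ be an integer and for $0\le j\le k\le\ell$ put $c_{j,k}=\binom{\ell}{k}^2\binom{k}{j}\frac{(2j)!(4\ell-2j)!}{j!(2\ell-j)!}$. Then, as polynomials in $z$, $$\sum_{k=0}^{\ell}\sum_{j=0}^{k}c_{j,k}(-z)^{\ell-k}(1-z)^{k-j}=\sum_{r=0}^{\ell}(-1)^r2^{2\ell-2r}\frac{(2\ell)!(2\ell+2r)!}{(r!)^2(\ell+r)!(\ell-r)!}z^r.$$ -}

module Defs where

open import Data.Nat as ℕ using (ℕ; zero; suc; _∸_; _!)
open import Data.Nat.Combinatorics using (_C_)
open import Data.Nat.Properties using (_!≢0; m*n≢0)
import Data.Nat.DivMod as ℕD
open import Data.Integer as ℤ using (ℤ; +_; _+_; _*_; -_; 0ℤ; 1ℤ; -1ℤ)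
open import Relation.Binary.PropositionalEquality using (_≡_)

-- Polynomials over ℤ in one variable z, represented by their coefficient
-- sequence (coefficient of z^n).  Every polynomial built below has finite
-- support, and equality of polynomials is coefficientwise equality.
Poly : Set
Poly = ℕ → ℤ

const : ℤ → Poly
const c zero    = c
const c (suc n) = 0ℤ

Z : Poly
Z zero          = 0ℤ
Z (suc zero)    = 1ℤ
Z (suc (suc n)) = 0ℤ

infixl 6 _⊕_
infixl 7 _⊛_ _·_

_⊕_ : Poly → Poly → Poly
(p ⊕ q) n = p n + q n

⊖_ : Poly → Poly
(⊖ p) n = - p n

_·_ : ℤ → Poly → Poly
(c · p) n = c * p n

-- finite sum  Σ_{i=0}^{n} f i  of integers
sumℤ : ℕ → (ℕ → ℤ) → ℤ
sumℤ zero    f = f zero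
sumℤ (suc n) f = sumℤ n f + f (suc n)

_⊛_ : Poly → Poly → Poly
(p ⊛ q) n = sumℤ n (λ i → p i * q (n ∸ i))

_^P_ : Poly → ℕ → Poly
p ^P zero  = const 1ℤ
p ^P suc n = p ⊛ (p ^P n)

sumP : ℕ → (ℕ → Poly) → Poly
sumP n f m = sumℤ n (λ i → f i m)

_≈P_ : Poly → Poly → Set
p ≈P q = ∀ n → p n ≡ q n

-- c_{j,k} = C(ℓ,k)^2 C(k,j) (2j)! (4ℓ-2j)! / (j! (2ℓ-j)!)   (exact division)
c : ℕ → ℕ → ℕ → ℕ
c ℓ j k = (ℓ C k) ℕ.* (ℓ C k) ℕ.* (k C j) ℕ.*
          ((((2 ℕ.* j) !) ℕ.* ((4 ℕ.* ℓ ∸ 2 ℕ.* j) !)) ℕD./ (j ! ℕ.* (2 ℕ.* ℓ ∸ j) !))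
  where instance _ = m*n≢0 (j !) ((2 ℕ.* ℓ ∸ j) !) {{j !≢0}} {{(2 ℕ.* ℓ ∸ j) !≢0}}

-- (2ℓ)! (2ℓ+2r)! / ((r!)^2 (ℓ+r)! (ℓ-r)!)   (exact division)
d : ℕ → ℕ → ℕ
d ℓ r = (((2 ℕ.* ℓ) !) ℕ.* ((2 ℕ.* ℓ ℕ.+ 2 ℕ.* r) !))
        ℕD./ ((r ! ℕ.* r !) ℕ.* ((ℓ ℕ.+ r) ! ℕ.* (ℓ ∸ r) !))
  where
  instance
    _ = m*n≢0 (r ! ℕ.* r !) ((ℓ ℕ.+ r) ! ℕ.* (ℓ ∸ r) !)
          {{m*n≢0 (r !) (r !) {{r !≢0}} {{r !≢0}}}}
          {{m*n≢0 ((ℓ ℕ.+ r) !) ((ℓ ∸ r) !) {{(ℓ ℕ.+ r) !≢0}} {{(ℓ ∸ r) !≢0}}}}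

LHS : ℕ → Poly
LHS ℓ = sumP ℓ (λ k → sumP k (λ j →
          (+ c ℓ j k) · ((⊖ Z) ^P (ℓ ∸ k) ⊛ (const 1ℤ ⊕ ⊖ Z) ^P (k ∸ j))))

RHS : ℕ → Poly
RHS ℓ = sumP ℓ (λ r →
          ((-1ℤ ℤ.^ r) * (+ (2 ℕ.^ (2 ℕ.* ℓ ∸ 2 ℕ.* r))) * (+ d ℓ r)) · (Z ^P r))

-- The coefficient of z^n in (-z)^a (1 - z)^b is (-1)^n C(b, n - a),
-- and 0 when n < a, so for n > ℓ both sides vanish.  For n = p ≤ ℓ = m + p the subset-of-a-subset
-- identity C(k,j) C(k-j, k-m) = C(k,m) C(m,j) factors the left-hand double sum as
--   Σ_k C(ℓ,k)² C(k,m) · S(m, 2ℓ),   S(m, N) = Σ_j C(m,j) Q(j) Q(N-j),   Q(n) = (2n)!/n!.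
-- Vandermonde's identity gives Σ_k C(ℓ,k)² C(k,m) = C(ℓ,m) C(ℓ+p,p).  Pascal's rule and
-- Q(j+1) = (4j+2) Q(j) give S(m+1, N+1) = 4(N+1) S(m, N), hence S(m, N) = 4^m C(N,m) m! Q(N-m).
-- Multiplying out the factorials, the product is 4^m d(ℓ,p), and 4^m = 2^(2ℓ-2p).
module Submission where

open import Algebra.Bundles using (CommutativeSemiring)
open import Data.Nat.Base as ℕ using (ℕ; zero; suc; _∸_; _≤_; _<_; z≤n; s≤s)
open import Data.Nat.Properties using (≤-refl; m≤n⇒m≤1+n; m≤n⇒m<n∨m≡n; _≤?_; m∸n+n≡m; ≰⇒>)
open import Data.Product.Base using (_,_)
open import Data.Sum.Base using (inj₁; inj₂)
open import Function.Base using (_∘_)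
open import Relation.Binary.PropositionalEquality using (_≡_; refl; subst)
open import Relation.Nullary.Decidable.Core using (yes; no)

open import Defs

module RangeSum {a ℓ} (R : CommutativeSemiring a ℓ) where

  open CommutativeSemiring R hiding (zero) renaming (refl to ≈-refl)
  open import Algebra.Properties.CommutativeSemigroup +-commutativeSemigroup using (interchange)
  open import Relation.Binary.Reasoning.Setoid setoid

  sum : ℕ → (ℕ → Carrier) → Carrier
  sum zero    f = f zero
  sum (suc n) f = sum n f + f (suc n)

  sum-cong : ∀ n {f g} → (∀ i → i ≤ n → f i ≈ g i) → sum n f ≈ sum n g
  sum-cong zero    f≈g = f≈g 0 z≤n
  sum-cong (suc n) f≈g = +-cong (sum-cong n (λ i i≤n → f≈g i (m≤n⇒m≤1+n i≤n))) (f≈g (suc n) ≤-refl)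

  sum-zero : ∀ n {f} → (∀ i → i ≤ n → f i ≈ 0#) → sum n f ≈ 0#
  sum-zero zero    f≈0 = f≈0 0 z≤n
  sum-zero (suc n) {f} f≈0 = begin
    sum n f + f (suc n) ≈⟨ +-cong (sum-zero n (λ i i≤n → f≈0 i (m≤n⇒m≤1+n i≤n))) (f≈0 (suc n) ≤-refl) ⟩
    0# + 0#             ≈⟨ +-identityˡ 0# ⟩
    0#                  ∎

  sum-cons : ∀ n f → sum (suc n) f ≈ f 0 + sum n (f ∘ suc)
  sum-cons zero    f = ≈-refl
  sum-cons (suc n) f = begin
    sum (suc n) f + f (suc (suc n))         ≈⟨ +-congʳ (sum-cons n f) ⟩
    f 0 + sum n (f ∘ suc) + f (suc (suc n)) ≈⟨ +-assoc (f 0) (sum n (f ∘ suc)) (f (suc (suc n))) ⟩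
    f 0 + sum (suc n) (f ∘ suc)             ∎

  sum-distrib-+ : ∀ n f g → sum n (λ i → f i + g i) ≈ sum n f + sum n g
  sum-distrib-+ zero    f g = ≈-refl
  sum-distrib-+ (suc n) f g = begin
    sum n (λ i → f i + g i) + (f (suc n) + g (suc n)) ≈⟨ +-congʳ (sum-distrib-+ n f g) ⟩
    sum n f + sum n g + (f (suc n) + g (suc n))       ≈⟨ interchange (sum n f) (sum n g) (f (suc n)) (g (suc n)) ⟩
    sum (suc n) f + sum (suc n) g                     ∎

  *-distribˡ-sum : ∀ n x f → x * sum n f ≈ sum n (λ i → x * f i)
  *-distribˡ-sum zero    x f = ≈-refl
  *-distribˡ-sum (suc n) x f = begin
    x * (sum n f + f (suc n))   ≈⟨ distribˡ x (sum n f) (f (suc n)) ⟩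
    x * sum n f + x * f (suc n) ≈⟨ +-congʳ (*-distribˡ-sum n x f) ⟩
    sum (suc n) (λ i → x * f i) ∎

  sum-last : ∀ m {f} → (∀ i → i < m → f i ≈ 0#) → sum m f ≈ f m
  sum-last zero    f≈0 = ≈-refl
  sum-last (suc m) {f} f≈0 = begin
    sum m f + f (suc m) ≈⟨ +-congʳ (sum-zero m (λ i i≤m → f≈0 i (s≤s i≤m))) ⟩
    0# + f (suc m)      ≈⟨ +-identityˡ (f (suc m)) ⟩
    f (suc m)           ∎

  sum-shift : ∀ m p f → (∀ i → i < m → f i ≈ 0#) → sum (m ℕ.+ p) f ≈ sum p (λ i → f (m ℕ.+ i))
  sum-shift zero    p f f≈0 = ≈-refl
  sum-shift (suc m) p f f≈0 = begin
    sum (suc (m ℕ.+ p)) f                ≈⟨ sum-cons (m ℕ.+ p) f ⟩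
    f 0 + sum (m ℕ.+ p) (f ∘ suc)        ≈⟨ +-cong (f≈0 0 (s≤s z≤n)) (sum-shift m p (f ∘ suc) (λ i i<m → f≈0 (suc i) (s≤s i<m))) ⟩
    0# + sum p (λ i → f (suc m ℕ.+ i))   ≈⟨ +-identityˡ _ ⟩
    sum p (λ i → f (suc m ℕ.+ i))        ∎

  sum-extend : ∀ {m n f} → m ≤ n → (∀ i → m < i → f i ≈ 0#) → sum n f ≈ sum m f
  sum-extend {n = zero}      z≤n   f≈0 = ≈-refl
  sum-extend {m} {suc n} {f} m≤1+n f≈0 with m≤n⇒m<n∨m≡n m≤1+n
  ... | inj₂ refl      = ≈-refl
  ... | inj₁ (s≤s m≤n) = begin
    sum n f + f (suc n) ≈⟨ +-cong (sum-extend m≤n f≈0) (f≈0 (suc n) (s≤s m≤n)) ⟩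
    sum m f + 0#        ≈⟨ +-identityʳ (sum m f) ⟩
    sum m f             ∎

module _ where

  open import Data.Nat.Base using (_+_; _*_; _^_; _!)
  open import Data.Nat.Properties
  open import Data.Nat.Combinatorics
    using (_C_; nCk≡n!/k![n-k]!; k![n∸k]!∣n!; k>n⇒nCk≡0; nCk≡nC[n∸k]; nCk+nC[k+1]≡[n+1]C[k+1])
  open import Data.Nat.DivMod using (_/_; m/n*n≡m; m*n/n≡m)
  open import Data.Nat.Tactic.RingSolver using (solve-∀)
  open import Algebra.Properties.CommutativeSemigroup +-commutativeSemigroup
    using () renaming (x∙yz≈y∙xz to x+[y+z]≡y+[x+z])
  open import Algebra.Properties.CommutativeSemigroup *-commutativeSemigroup
    using () renaming (x∙yz≈y∙xz to x*[y*z]≡y*[x*z]; interchange to [w*x]*[y*z]≡[w*y]*[x*z])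
  open import Relation.Binary.PropositionalEquality
  open RangeSum +-*-commutativeSemiring
  open ≡-Reasoning

  nCk*[k!*[n∸k]!]≡n! : ∀ {n k} → k ≤ n → (n C k) * (k ! * (n ∸ k) !) ≡ n !
  nCk*[k!*[n∸k]!]≡n! {n} {k} k≤n = begin
    (n C k) * (k ! * (n ∸ k) !)                 ≡⟨ cong (_* (k ! * (n ∸ k) !)) (nCk≡n!/k![n-k]! k≤n) ⟩
    n ! / (k ! * (n ∸ k) !) * (k ! * (n ∸ k) !) ≡⟨ m/n*n≡m (k![n∸k]!∣n! k≤n) ⟩
    n !                                         ∎
    where instance _ = k !* (n ∸ k) !≢0

  [m+n]Cm*[m!*n!]≡[m+n]! : ∀ m n → ((m + n) C m) * (m ! * n !) ≡ (m + n) !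
  [m+n]Cm*[m!*n!]≡[m+n]! m n = begin
    ((m + n) C m) * (m ! * n !)           ≡⟨ cong (λ x → ((m + n) C m) * (m ! * x !)) (m+n∸m≡n m n) ⟨
    ((m + n) C m) * (m ! * (m + n ∸ m) !) ≡⟨ nCk*[k!*[n∸k]!]≡n! (m≤m+n m n) ⟩
    (m + n) !                             ∎

  [m+n]Cm≡[m+n]Cn : ∀ m n → (m + n) C m ≡ (m + n) C n
  [m+n]Cm≡[m+n]Cn m n = trans (nCk≡nC[n∸k] (m≤m+n m n)) (cong ((m + n) C_) (m+n∸m≡n m n))

  [a+b+c]C[a+b]*[a+b]Ca≡[a+[b+c]]Ca*[b+c]Cb : ∀ a b c →
    ((a + b + c) C (a + b)) * ((a + b) C a) ≡ ((a + (b + c)) C a) * ((b + c) C b)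
  [a+b+c]C[a+b]*[a+b]Ca≡[a+[b+c]]Ca*[b+c]Cb a b c =
    *-cancelʳ-≡ _ _ (a ! * (b ! * c !)) {{m*n≢0 _ _ {{a !≢0}} {{b !* c !≢0}}}} (begin
      x * y * (a ! * (b ! * c !))   ≡⟨ regroupˡ x y (a !) (b !) (c !) ⟩
      x * (y * (a ! * b !) * c !)   ≡⟨ cong (λ z → x * (z * c !)) ([m+n]Cm*[m!*n!]≡[m+n]! a b) ⟩
      x * ((a + b) ! * c !)         ≡⟨ [m+n]Cm*[m!*n!]≡[m+n]! (a + b) c ⟩
      (a + b + c) !                 ≡⟨ cong _! (+-assoc a b c) ⟩
      (a + (b + c)) !               ≡⟨ [m+n]Cm*[m!*n!]≡[m+n]! a (b + c) ⟨
      u * (a ! * (b + c) !)         ≡⟨ cong (λ z → u * (a ! * z)) ([m+n]Cm*[m!*n!]≡[m+n]! b c) ⟨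
      u * (a ! * (v * (b ! * c !))) ≡⟨ regroupʳ u v (a !) (b !) (c !) ⟩
      u * v * (a ! * (b ! * c !))   ∎)
    where
    x y u v : ℕ
    x = (a + b + c) C (a + b)
    y = (a + b) C a
    u = (a + (b + c)) C a
    v = (b + c) C b
    regroupˡ : ∀ x y u v w → x * y * (u * (v * w)) ≡ x * (y * (u * v) * w)
    regroupˡ = solve-∀
    regroupʳ : ∀ x y u v w → x * (u * (y * (v * w))) ≡ x * y * (u * (v * w))
    regroupʳ = solve-∀

  [m+u]Cj*[m+u∸j]Cu≡[m+u]Cm*mCj : ∀ m u {j} → j ≤ m + u →
    ((m + u) C j) * ((m + u ∸ j) C u) ≡ ((m + u) C m) * (m C j)
  [m+u]Cj*[m+u∸j]Cu≡[m+u]Cm*mCj m u {j} j≤m+u with j ≤? m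
  ... | no j≰m = begin
    ((m + u) C j) * ((m + u ∸ j) C u) ≡⟨ cong (((m + u) C j) *_) (k>n⇒nCk≡0 m+u∸j<u) ⟩
    ((m + u) C j) * 0                 ≡⟨ *-zeroʳ ((m + u) C j) ⟩
    0                                 ≡⟨ *-zeroʳ ((m + u) C m) ⟨
    ((m + u) C m) * 0                 ≡⟨ cong (((m + u) C m) *_) (k>n⇒nCk≡0 (≰⇒> j≰m)) ⟨
    ((m + u) C m) * (m C j)           ∎
    where
    m+u∸j<u : m + u ∸ j < u
    m+u∸j<u = subst (m + u ∸ j <_) (m+n∸m≡n m u) (∸-monoʳ-< (≰⇒> j≰m) j≤m+u)
  ... | yes j≤m with m≤n⇒∃[o]m+o≡n j≤m
  ... | v , refl = begin
    ((j + v + u) C j) * ((j + v + u ∸ j) C u)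
      ≡⟨ cong₂ (λ x y → (x C j) * (y C u)) (+-assoc j v u) (trans (cong (_∸ j) (+-assoc j v u)) (m+n∸m≡n j (v + u))) ⟩
    ((j + (v + u)) C j) * ((v + u) C u)
      ≡⟨ cong (((j + (v + u)) C j) *_) ([m+n]Cm≡[m+n]Cn v u) ⟨
    ((j + (v + u)) C j) * ((v + u) C v)
      ≡⟨ [a+b+c]C[a+b]*[a+b]Ca≡[a+[b+c]]Ca*[b+c]Cb j v u ⟨
    ((j + v + u) C (j + v)) * ((j + v) C j)
      ∎

  sum-pascal : ∀ a n (f : ℕ → ℕ) →
    sum (suc n) (λ j → (suc a C j) * f j) ≡ sum n (λ j → (a C j) * f (suc j)) + sum (suc n) (λ j → (a C j) * f j)
  sum-pascal a n f = begin
    sum (suc n) (λ j → (suc a C j) * f j)   ≡⟨ sum-cons n (λ j → (suc a C j) * f j) ⟩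
    f₀ + sum n (λ j → (suc a C suc j) * f (suc j))
                                            ≡⟨ cong (f₀ +_) (sum-cong n (λ j _ → pascal j)) ⟩
    f₀ + sum n (λ j → g j + h j)            ≡⟨ cong (f₀ +_) (sum-distrib-+ n g h) ⟩
    f₀ + (sum n g + sum n h)                ≡⟨ x+[y+z]≡y+[x+z] f₀ (sum n g) (sum n h) ⟩
    sum n g + (f₀ + sum n h)                ≡⟨ cong (sum n g +_) (sum-cons n (λ j → (a C j) * f j)) ⟨
    sum n g + sum (suc n) (λ j → (a C j) * f j) ∎
    where
    f₀ : ℕ
    f₀ = (a C 0) * f 0
    g h : ℕ → ℕ
    g j = (a C j) * f (suc j)
    h j = (a C suc j) * f (suc j)
    pascal : ∀ j → (suc a C suc j) * f (suc j) ≡ g j + h j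
    pascal j = begin
      (suc a C suc j) * f (suc j)         ≡⟨ cong (_* f (suc j)) (nCk+nC[k+1]≡[n+1]C[k+1] a j) ⟨
      ((a C j) + (a C suc j)) * f (suc j) ≡⟨ *-distribʳ-+ (f (suc j)) (a C j) (a C suc j) ⟩
      g j + h j                           ∎

  vandermonde : ∀ a b n → sum n (λ i → (a C i) * (b C (n ∸ i))) ≡ (a + b) C n
  vandermonde zero    b n       = trans (sum-extend {n = n} z≤n 0Ci≡0) (*-identityˡ (b C n))
    where
    0Ci≡0 : ∀ i → 0 < i → (0 C i) * (b C (n ∸ i)) ≡ 0
    0Ci≡0 (suc i) _ = refl
  vandermonde (suc a) b zero    = refl
  vandermonde (suc a) b (suc n) = begin
    sum (suc n) (λ i → (suc a C i) * (b C (suc n ∸ i)))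
      ≡⟨ sum-pascal a n (λ i → b C (suc n ∸ i)) ⟩
    sum n (λ i → (a C i) * (b C (n ∸ i))) + sum (suc n) (λ i → (a C i) * (b C (suc n ∸ i)))
      ≡⟨ cong₂ _+_ (vandermonde a b n) (vandermonde a b (suc n)) ⟩
    ((a + b) C n) + ((a + b) C suc n)
      ≡⟨ nCk+nC[k+1]≡[n+1]C[k+1] (a + b) n ⟩
    (suc a + b) C suc n
      ∎

  nCm*sumₙ≡nCm*sumₘ : ∀ {m} n f → (∀ j → m < j → f j ≡ 0) → (n C m) * sum n f ≡ (n C m) * sum m f
  nCm*sumₙ≡nCm*sumₘ {m} n f f≡0 with m ≤? n
  ... | yes m≤n = cong ((n C m) *_) (sum-extend m≤n f≡0)
  ... | no  m≰n = trans (cong (_* sum n f) nCm≡0) (sym (cong (_* sum m f) nCm≡0))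
    where
    nCm≡0 : n C m ≡ 0
    nCm≡0 = k>n⇒nCk≡0 (≰⇒> m≰n)

  -- The coefficient of z^n in z^a (1 + z)^b.
  shiftedC : ℕ → ℕ → ℕ → ℕ
  shiftedC zero    b n       = b C n
  shiftedC (suc a) b zero    = 0
  shiftedC (suc a) b (suc n) = shiftedC a b n

  shiftedC-< : ∀ {a} b {n} → n < a → shiftedC a b n ≡ 0
  shiftedC-< {suc a} b {zero}  _         = refl
  shiftedC-< {suc a} b {suc n} (s≤s n<a) = shiftedC-< b n<a

  shiftedC-≥ : ∀ {a} b {n} → a ≤ n → shiftedC a b n ≡ b C (n ∸ a)
  shiftedC-≥ {zero}  b z≤n       = refl
  shiftedC-≥ {suc a} b (s≤s a≤n) = shiftedC-≥ b a≤n

  shiftedC-> : ∀ a b {n} → b + a < n → shiftedC a b n ≡ 0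
  shiftedC-> zero    b {n}     b+0<n     = k>n⇒nCk≡0 (subst (_< n) (+-identityʳ b) b+0<n)
  shiftedC-> (suc a) b {suc n} b+1+a<1+n = shiftedC-> a b (≤-pred (subst (_< suc n) (+-suc b a) b+1+a<1+n))

  kCj*shiftedC≡kCm*mCj : ∀ m p {j k} → j ≤ k → k ≤ m + p →
    (k C j) * shiftedC (m + p ∸ k) (k ∸ j) p ≡ (k C m) * (m C j)
  kCj*shiftedC≡kCm*mCj m p {j} {k} j≤k k≤m+p with m ≤? k
  ... | no m≰k = begin
    (k C j) * shiftedC (m + p ∸ k) (k ∸ j) p ≡⟨ cong ((k C j) *_) (shiftedC-< (k ∸ j) p<m+p∸k) ⟩
    (k C j) * 0                              ≡⟨ *-zeroʳ (k C j) ⟩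
    0 * (m C j)                              ≡⟨ cong (_* (m C j)) (k>n⇒nCk≡0 (≰⇒> m≰k)) ⟨
    (k C m) * (m C j)                        ∎
    where
    p<m+p∸k : p < m + p ∸ k
    p<m+p∸k = subst (p <_) (sym (+-∸-comm p (<⇒≤ (≰⇒> m≰k)))) (m<n+m p (m<n⇒0<n∸m (≰⇒> m≰k)))
  ... | yes m≤k with m≤n⇒∃[o]m+o≡n m≤k
  ... | u , refl = begin
    ((m + u) C j) * shiftedC (m + p ∸ (m + u)) (m + u ∸ j) p
      ≡⟨ cong (λ a → ((m + u) C j) * shiftedC a (m + u ∸ j) p) ([m+n]∸[m+o]≡n∸o m p u) ⟩
    ((m + u) C j) * shiftedC (p ∸ u) (m + u ∸ j) p
      ≡⟨ cong (((m + u) C j) *_) (shiftedC-≥ (m + u ∸ j) (m∸n≤m p u)) ⟩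
    ((m + u) C j) * ((m + u ∸ j) C (p ∸ (p ∸ u)))
      ≡⟨ cong (λ i → ((m + u) C j) * ((m + u ∸ j) C i)) (m∸[m∸n]≡n (+-cancelˡ-≤ m u p k≤m+p)) ⟩
    ((m + u) C j) * ((m + u ∸ j) C u)
      ≡⟨ [m+u]Cj*[m+u∸j]Cu≡[m+u]Cm*mCj m u j≤k ⟩
    ((m + u) C m) * (m C j)
      ∎

  quadFactorial : ℕ → ℕ
  quadFactorial zero    = 1
  quadFactorial (suc n) = (2 + 4 * n) * quadFactorial n

  quadFactorial*n!≡[2n]! : ∀ n → quadFactorial n * n ! ≡ (2 * n) !
  quadFactorial*n!≡[2n]! zero    = refl
  quadFactorial*n!≡[2n]! (suc n) = begin
    (2 + 4 * n) * quadFactorial n * ((1 + n) * n !)       ≡⟨ regroup n (quadFactorial n) (n !) ⟩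
    (2 + 2 * n) * ((1 + 2 * n) * (quadFactorial n * n !)) ≡⟨ cong (λ x → (2 + 2 * n) * ((1 + 2 * n) * x)) (quadFactorial*n!≡[2n]! n) ⟩
    (2 + 2 * n) !                                         ≡⟨ cong _! (*-suc 2 n) ⟨
    (2 * suc n) !                                         ∎
    where
    regroup : ∀ n q f → (2 + 4 * n) * q * ((1 + n) * f) ≡ (2 + 2 * n) * ((1 + 2 * n) * (q * f))
    regroup = solve-∀

  quadFactorial-step : ∀ {j N} → j ≤ N →
    quadFactorial (suc j) * quadFactorial (N ∸ j) + quadFactorial j * quadFactorial (suc N ∸ j)
      ≡ 4 * suc N * (quadFactorial j * quadFactorial (N ∸ j))
  quadFactorial-step {j} {N} j≤N = begin
    (2 + 4 * j) * q * r + q * quadFactorial (suc N ∸ j)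
      ≡⟨ cong (λ x → (2 + 4 * j) * q * r + q * quadFactorial x) (+-∸-assoc 1 j≤N) ⟩
    (2 + 4 * j) * q * r + q * ((2 + 4 * t) * r)
      ≡⟨ collect j t q r ⟩
    4 * suc (j + t) * (q * r)
      ≡⟨ cong (λ x → 4 * suc x * (q * r)) (m+[n∸m]≡n j≤N) ⟩
    4 * suc N * (q * r)
      ∎
    where
    t q r : ℕ
    t = N ∸ j
    q = quadFactorial j
    r = quadFactorial t
    collect : ∀ j t q r → (2 + 4 * j) * q * r + q * ((2 + 4 * t) * r) ≡ 4 * suc (j + t) * (q * r)
    collect = solve-∀

  convolveQ : ℕ → ℕ → ℕ
  convolveQ m N = sum m (λ j → (m C j) * (quadFactorial j * quadFactorial (N ∸ j)))

  convolveQ-suc : ∀ {m N} → m ≤ N → convolveQ (suc m) (suc N) ≡ 4 * suc N * convolveQ m N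
  convolveQ-suc {m} {N} m≤N = begin
    sum (suc m) (λ j → (suc m C j) * g j)                              ≡⟨ sum-pascal m m g ⟩
    sum m (λ j → (m C j) * g (suc j)) + sum (suc m) (λ j → (m C j) * g j)
      ≡⟨ cong (sum m (λ j → (m C j) * g (suc j)) +_) (sum-extend (n≤1+n m) mCj≡0) ⟩
    sum m (λ j → (m C j) * g (suc j)) + sum m (λ j → (m C j) * g j)
      ≡⟨ sum-distrib-+ m (λ j → (m C j) * g (suc j)) (λ j → (m C j) * g j) ⟨
    sum m (λ j → (m C j) * g (suc j) + (m C j) * g j)                  ≡⟨ sum-cong m pointwise ⟩
    sum m (λ j → 4 * suc N * ((m C j) * f j))                          ≡⟨ *-distribˡ-sum m (4 * suc N) (λ j → (m C j) * f j) ⟨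
    4 * suc N * convolveQ m N                                          ∎
    where
    f g : ℕ → ℕ
    f j = quadFactorial j * quadFactorial (N ∸ j)
    g j = quadFactorial j * quadFactorial (suc N ∸ j)
    mCj≡0 : ∀ j → m < j → (m C j) * g j ≡ 0
    mCj≡0 j m<j = cong (_* g j) (k>n⇒nCk≡0 m<j)
    pointwise : ∀ j → j ≤ m → (m C j) * g (suc j) + (m C j) * g j ≡ 4 * suc N * ((m C j) * f j)
    pointwise j j≤m = begin
      (m C j) * g (suc j) + (m C j) * g j ≡⟨ *-distribˡ-+ (m C j) (g (suc j)) (g j) ⟨
      (m C j) * (g (suc j) + g j)         ≡⟨ cong ((m C j) *_) (quadFactorial-step (≤-trans j≤m m≤N)) ⟩
      (m C j) * (4 * suc N * f j)         ≡⟨ x*[y*z]≡y*[x*z] (m C j) (4 * suc N) (f j) ⟩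
      4 * suc N * ((m C j) * f j)         ∎

  convolveQ*[N∸m]! : ∀ {m N} → m ≤ N → convolveQ m N * (N ∸ m) ! ≡ 4 ^ m * N ! * quadFactorial (N ∸ m)
  convolveQ*[N∸m]! {zero}  {N}     _         = unit (quadFactorial N) (N !)
    where
    unit : ∀ q f → 1 * (1 * q) * f ≡ 1 * f * q
    unit = solve-∀
  convolveQ*[N∸m]! {suc m} {suc N} (s≤s m≤N) = begin
    convolveQ (suc m) (suc N) * (N ∸ m) !   ≡⟨ cong (_* (N ∸ m) !) (convolveQ-suc m≤N) ⟩
    4 * suc N * convolveQ m N * (N ∸ m) !   ≡⟨ *-assoc (4 * suc N) (convolveQ m N) ((N ∸ m) !) ⟩
    4 * suc N * (convolveQ m N * (N ∸ m) !) ≡⟨ cong (4 * suc N *_) (convolveQ*[N∸m]! m≤N) ⟩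
    4 * suc N * (4 ^ m * N ! * q)           ≡⟨ regroup N (4 ^ m) (N !) q ⟩
    4 * 4 ^ m * (suc N * N !) * q           ∎
    where
    q : ℕ
    q = quadFactorial (N ∸ m)
    regroup : ∀ N a f q → 4 * suc N * (a * f * q) ≡ 4 * a * (suc N * f) * q
    regroup = solve-∀

  convolveQ-closedForm : ∀ {m N} → m ≤ N → convolveQ m N ≡ 4 ^ m * ((N C m) * m !) * quadFactorial (N ∸ m)
  convolveQ-closedForm {m} {N} m≤N = *-cancelʳ-≡ _ _ ((N ∸ m) !) {{(N ∸ m) !≢0}} (begin
    convolveQ m N * (N ∸ m) !                 ≡⟨ convolveQ*[N∸m]! m≤N ⟩
    4 ^ m * N ! * q                           ≡⟨ cong (λ x → 4 ^ m * x * q) (nCk*[k!*[n∸k]!]≡n! m≤N) ⟨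
    4 ^ m * ((N C m) * (m ! * (N ∸ m) !)) * q ≡⟨ regroup (4 ^ m) (N C m) (m !) ((N ∸ m) !) q ⟩
    4 ^ m * ((N C m) * m !) * q * (N ∸ m) !   ∎)
    where
    q : ℕ
    q = quadFactorial (N ∸ m)
    regroup : ∀ a b x y q → a * (b * (x * y)) * q ≡ a * (b * x) * q * y
    regroup = solve-∀

  sum[ℓCk]²kCm≡ℓCm*[p+ℓ]Cp : ∀ m p →
    sum (m + p) (λ k → ((m + p) C k) * ((m + p) C k) * (k C m)) ≡ ((m + p) C m) * ((p + (m + p)) C p)
  sum[ℓCk]²kCm≡ℓCm*[p+ℓ]Cp m p = begin
    sum ℓ K                                           ≡⟨ sum-shift m p K below-m ⟩
    sum p (λ i → K (m + i))                           ≡⟨ sum-cong p shifted-term ⟩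
    sum p (λ i → (ℓ C m) * ((p C i) * (ℓ C (p ∸ i)))) ≡⟨ *-distribˡ-sum p (ℓ C m) (λ i → (p C i) * (ℓ C (p ∸ i))) ⟨
    (ℓ C m) * sum p (λ i → (p C i) * (ℓ C (p ∸ i)))   ≡⟨ cong ((ℓ C m) *_) (vandermonde p ℓ p) ⟩
    (ℓ C m) * ((p + ℓ) C p)                           ∎
    where
    ℓ : ℕ
    ℓ = m + p
    K : ℕ → ℕ
    K k = (ℓ C k) * (ℓ C k) * (k C m)
    below-m : ∀ k → k < m → K k ≡ 0
    below-m k k<m = trans (cong ((ℓ C k) * (ℓ C k) *_) (k>n⇒nCk≡0 k<m)) (*-zeroʳ ((ℓ C k) * (ℓ C k)))
    shifted-term : ∀ i → i ≤ p → K (m + i) ≡ (ℓ C m) * ((p C i) * (ℓ C (p ∸ i)))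
    shifted-term i i≤p with m≤n⇒∃[o]m+o≡n i≤p
    ... | q , refl = begin
      (ℓ C (m + i)) * (ℓ C (m + i)) * ((m + i) C m)   ≡⟨ *-assoc (ℓ C (m + i)) (ℓ C (m + i)) ((m + i) C m) ⟩
      (ℓ C (m + i)) * ((ℓ C (m + i)) * ((m + i) C m)) ≡⟨ cong ((ℓ C (m + i)) *_) revision ⟩
      (ℓ C (m + i)) * ((ℓ C m) * ((i + q) C i))       ≡⟨ cong (_* ((ℓ C m) * ((i + q) C i))) symmetry ⟩
      (ℓ C (i + q ∸ i)) * ((ℓ C m) * ((i + q) C i))   ≡⟨ regroup (ℓ C (i + q ∸ i)) (ℓ C m) ((i + q) C i) ⟩
      (ℓ C m) * (((i + q) C i) * (ℓ C (i + q ∸ i)))   ∎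
      where
      revision : (ℓ C (m + i)) * ((m + i) C m) ≡ (ℓ C m) * ((i + q) C i)
      revision = subst (λ n → (n C (m + i)) * ((m + i) C m) ≡ (ℓ C m) * ((i + q) C i))
                       (+-assoc m i q) ([a+b+c]C[a+b]*[a+b]Ca≡[a+[b+c]]Ca*[b+c]Cb m i q)
      symmetry : ℓ C (m + i) ≡ ℓ C (i + q ∸ i)
      symmetry = subst (λ n → n C (m + i) ≡ n C (i + q ∸ i)) (+-assoc m i q)
                       (trans ([m+n]Cm≡[m+n]Cn (m + i) q) (cong ((m + i + q) C_) (sym (m+n∸m≡n i q))))
      regroup : ∀ x y z → x * (y * z) ≡ y * (z * x)
      regroup = solve-∀

  c-closedForm : ∀ ℓ j k → c ℓ j k ≡ (ℓ C k) * (ℓ C k) * (k C j) * (quadFactorial j * quadFactorial (2 * ℓ ∸ j))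
  c-closedForm ℓ j k = cong ((ℓ C k) * (ℓ C k) * (k C j) *_) (begin
    (2 * j) ! * (4 * ℓ ∸ 2 * j) ! / (j ! * x !)                  ≡⟨ cong (λ y → (2 * j) ! * y ! / (j ! * x !)) 4ℓ∸2j≡2x ⟩
    (2 * j) ! * (2 * x) ! / (j ! * x !)                           ≡⟨ cong (_/ (j ! * x !)) factorials ⟩
    quadFactorial j * quadFactorial x * (j ! * x !) / (j ! * x !) ≡⟨ m*n/n≡m _ (j ! * x !) ⟩
    quadFactorial j * quadFactorial x                             ∎)
    where
    x : ℕ
    x = 2 * ℓ ∸ j
    instance _ = j !* x !≢0
    4ℓ∸2j≡2x : 4 * ℓ ∸ 2 * j ≡ 2 * x
    4ℓ∸2j≡2x = trans (cong (_∸ 2 * j) (*-assoc 2 2 ℓ)) (sym (*-distribˡ-∸ 2 (2 * ℓ) j))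
    factorials : (2 * j) ! * (2 * x) ! ≡ quadFactorial j * quadFactorial x * (j ! * x !)
    factorials = begin
      (2 * j) ! * (2 * x) !                           ≡⟨ cong₂ _*_ (quadFactorial*n!≡[2n]! j) (quadFactorial*n!≡[2n]! x) ⟨
      quadFactorial j * j ! * (quadFactorial x * x !) ≡⟨ [w*x]*[y*z]≡[w*y]*[x*z] (quadFactorial j) (j !) (quadFactorial x) (x !) ⟩
      quadFactorial j * quadFactorial x * (j ! * x !) ∎

  d-closedForm : ∀ m p → d (m + p) p ≡
    ((m + p) C m) * ((p + (m + p)) C p) * (((2 * (m + p)) C m) * m ! * quadFactorial (2 * (m + p) ∸ m))
  d-closedForm m p = trans (cong (_/ Y) (sym T*Y≡X)) (m*n/n≡m T Y)
    where
    ℓ R N T Y : ℕ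
    ℓ = m + p
    R = p + ℓ
    N = 2 * ℓ
    T = (ℓ C m) * (R C p) * ((N C m) * m ! * quadFactorial (N ∸ m))
    Y = (p ! * p !) * ((ℓ + p) ! * (ℓ ∸ p) !)
    instance
      _ = m*n≢0 (p ! * p !) ((ℓ + p) ! * (ℓ ∸ p) !) {{p !* p !≢0}} {{(ℓ + p) !* (ℓ ∸ p) !≢0}}
    N∸m≡R : N ∸ m ≡ R
    N∸m≡R = trans (cong (_∸ m) (split m p)) (m+n∸m≡n m R)
      where
      split : ∀ m p → 2 * (m + p) ≡ m + (p + (m + p))
      split = solve-∀
    regroup : ∀ b₁ b₂ b₃ m! q p! r! → b₁ * b₂ * (b₃ * m! * q) * ((p! * p!) * (r! * m!))
                                      ≡ b₃ * (m! * (b₂ * (p! * (b₁ * (m! * p!))))) * (q * r!)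
    regroup = solve-∀
    T*Y≡X : T * Y ≡ N ! * (N + 2 * p) !
    T*Y≡X = begin
      T * Y
        ≡⟨ cong₂ (λ x y → T * ((p ! * p !) * (x ! * y !))) (+-comm ℓ p) (m+n∸n≡m m p) ⟩
      T * ((p ! * p !) * (R ! * m !))
        ≡⟨ regroup (ℓ C m) (R C p) (N C m) (m !) (quadFactorial (N ∸ m)) (p !) (R !) ⟩
      (N C m) * (m ! * ((R C p) * (p ! * ((ℓ C m) * (m ! * p !))))) * (quadFactorial (N ∸ m) * R !)
        ≡⟨ cong (λ x → (N C m) * (m ! * ((R C p) * (p ! * x))) * (quadFactorial (N ∸ m) * R !)) ([m+n]Cm*[m!*n!]≡[m+n]! m p) ⟩
      (N C m) * (m ! * ((R C p) * (p ! * ℓ !))) * (quadFactorial (N ∸ m) * R !)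
        ≡⟨ cong (λ x → (N C m) * (m ! * x) * (quadFactorial (N ∸ m) * R !)) ([m+n]Cm*[m!*n!]≡[m+n]! p ℓ) ⟩
      (N C m) * (m ! * R !) * (quadFactorial (N ∸ m) * R !)
        ≡⟨ cong (λ x → (N C m) * (m ! * x !) * (quadFactorial (N ∸ m) * R !)) N∸m≡R ⟨
      (N C m) * (m ! * (N ∸ m) !) * (quadFactorial (N ∸ m) * R !)
        ≡⟨ cong₂ _*_ (nCk*[k!*[n∸k]!]≡n! m≤N) (trans (cong (λ x → quadFactorial x * R !) N∸m≡R) (quadFactorial*n!≡[2n]! R)) ⟩
      N ! * (2 * R) !
        ≡⟨ cong (λ x → N ! * x !) (trans (*-distribˡ-+ 2 p ℓ) (+-comm (2 * p) N)) ⟩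
      N ! * (N + 2 * p) !
        ∎
      where
      m≤N : m ≤ N
      m≤N = ≤-trans (m≤m+n m p) (m≤n*m ℓ 2)

  lhsCoeff : ℕ → ℕ → ℕ
  lhsCoeff ℓ n = sum ℓ (λ k → sum k (λ j → c ℓ j k * shiftedC (ℓ ∸ k) (k ∸ j) n))

  lhsCoeff-vanish : ∀ {ℓ n} → ℓ < n → lhsCoeff ℓ n ≡ 0
  lhsCoeff-vanish {ℓ} {n} ℓ<n = sum-zero ℓ (λ k k≤ℓ → sum-zero k (λ j _ →
    trans (cong (c ℓ j k *_) (shiftedC-> (ℓ ∸ k) (k ∸ j) (≤-<-trans (exponents≤ℓ k j k≤ℓ) ℓ<n)))
          (*-zeroʳ (c ℓ j k))))
    where
    exponents≤ℓ : ∀ k j → k ≤ ℓ → k ∸ j + (ℓ ∸ k) ≤ ℓ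
    exponents≤ℓ k j k≤ℓ = ≤-trans (+-monoˡ-≤ (ℓ ∸ k) (m∸n≤m k j)) (≤-reflexive (m+[n∸m]≡n k≤ℓ))

  lhsCoeff-summand : ∀ m p {j k} → j ≤ k → k ≤ m + p →
    c (m + p) j k * shiftedC (m + p ∸ k) (k ∸ j) p
      ≡ ((m + p) C k) * ((m + p) C k) * (k C m) * ((m C j) * (quadFactorial j * quadFactorial (2 * (m + p) ∸ j)))
  lhsCoeff-summand m p {j} {k} j≤k k≤ℓ = begin
    c ℓ j k * e                                   ≡⟨ cong (_* e) (c-closedForm ℓ j k) ⟩
    (ℓ C k) * (ℓ C k) * (k C j) * a * e           ≡⟨ regroupˡ ((ℓ C k) * (ℓ C k)) (k C j) a e ⟩
    (ℓ C k) * (ℓ C k) * a * ((k C j) * e)         ≡⟨ cong ((ℓ C k) * (ℓ C k) * a *_) (kCj*shiftedC≡kCm*mCj m p j≤k k≤ℓ) ⟩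
    (ℓ C k) * (ℓ C k) * a * ((k C m) * (m C j))   ≡⟨ regroupʳ ((ℓ C k) * (ℓ C k)) a (k C m) (m C j) ⟩
    (ℓ C k) * (ℓ C k) * (k C m) * ((m C j) * a)   ∎
    where
    ℓ a e : ℕ
    ℓ = m + p
    a = quadFactorial j * quadFactorial (2 * ℓ ∸ j)
    e = shiftedC (ℓ ∸ k) (k ∸ j) p
    regroupˡ : ∀ x y a e → x * y * a * e ≡ x * a * (y * e)
    regroupˡ = solve-∀
    regroupʳ : ∀ x a u v → x * a * (u * v) ≡ x * u * (v * a)
    regroupʳ = solve-∀

  lhsCoeff-closedForm : ∀ m p → lhsCoeff (m + p) p ≡ 4 ^ m * d (m + p) p
  lhsCoeff-closedForm m p = begin
    lhsCoeff ℓ p                                    ≡⟨ sum-cong ℓ (λ k k≤ℓ → sum-cong k (λ j j≤k → lhsCoeff-summand m p j≤k k≤ℓ)) ⟩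
    sum ℓ (λ k → sum k (λ j → K k * f j))           ≡⟨ sum-cong ℓ (λ k _ → *-distribˡ-sum k (K k) f) ⟨
    sum ℓ (λ k → K k * sum k f)                     ≡⟨ sum-cong ℓ (λ k _ → truncate k) ⟩
    sum ℓ (λ k → convolveQ m N * K k)               ≡⟨ *-distribˡ-sum ℓ (convolveQ m N) K ⟨
    convolveQ m N * sum ℓ K                         ≡⟨ cong₂ _*_ (convolveQ-closedForm m≤N) (sum[ℓCk]²kCm≡ℓCm*[p+ℓ]Cp m p) ⟩
    4 ^ m * ((N C m) * m !) * q * ((ℓ C m) * (R C p)) ≡⟨ regroup (4 ^ m) ((N C m) * m !) q (ℓ C m) (R C p) ⟩
    4 ^ m * ((ℓ C m) * (R C p) * ((N C m) * m ! * q)) ≡⟨ cong (4 ^ m *_) (d-closedForm m p) ⟨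
    4 ^ m * d ℓ p                                   ∎
    where
    ℓ R N q : ℕ
    ℓ = m + p
    R = p + ℓ
    N = 2 * ℓ
    q = quadFactorial (N ∸ m)
    K f : ℕ → ℕ
    K k = (ℓ C k) * (ℓ C k) * (k C m)
    f j = (m C j) * (quadFactorial j * quadFactorial (N ∸ j))
    m≤N : m ≤ N
    m≤N = ≤-trans (m≤m+n m p) (m≤n*m ℓ 2)
    regroup : ∀ a b q x y → a * b * q * (x * y) ≡ a * (x * y * (b * q))
    regroup = solve-∀
    truncate : ∀ k → K k * sum k f ≡ convolveQ m N * K k
    truncate k = begin
      (ℓ C k) * (ℓ C k) * (k C m) * sum k f           ≡⟨ *-assoc ((ℓ C k) * (ℓ C k)) (k C m) (sum k f) ⟩
      (ℓ C k) * (ℓ C k) * ((k C m) * sum k f)         ≡⟨ cong ((ℓ C k) * (ℓ C k) *_) (nCm*sumₙ≡nCm*sumₘ k f m<j⇒fj≡0) ⟩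
      (ℓ C k) * (ℓ C k) * ((k C m) * convolveQ m N)   ≡⟨ regroup′ ((ℓ C k) * (ℓ C k)) (k C m) (convolveQ m N) ⟩
      convolveQ m N * K k                             ∎
      where
      m<j⇒fj≡0 : ∀ j → m < j → f j ≡ 0
      m<j⇒fj≡0 j m<j = cong (_* (quadFactorial j * quadFactorial (N ∸ j))) (k>n⇒nCk≡0 m<j)
      regroup′ : ∀ x y s → x * (y * s) ≡ s * (x * y)
      regroup′ = solve-∀

module _ where

  open import Data.Integer.Base using (ℤ; +_; _+_; _*_; 0ℤ; 1ℤ; -1ℤ; _^_)
  open import Data.Integer.Properties
    using (+-identityˡ; +-identityʳ; *-identityˡ; *-identityʳ; *-zeroʳ; *-assoc; *-distribˡ-+; pos-*;
           *-commutativeSemigroup; +-*-commutativeSemiring)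
  open import Data.Integer.Tactic.RingSolver using (solve-∀)
  open import Algebra.Properties.CommutativeSemigroup *-commutativeSemigroup
    using () renaming (x∙yz≈y∙xz to x*[y*z]≡y*[x*z])
  import Data.Nat.Properties as ℕₚ
  open import Data.Nat.Combinatorics using (_C_; nCk+nC[k+1]≡[n+1]C[k+1])
  open import Relation.Binary.PropositionalEquality
  open ≡-Reasoning

  module ℕ∑ = RangeSum ℕₚ.+-*-commutativeSemiring
  module ℤ∑ = RangeSum +-*-commutativeSemiring

  sumℤ≡sum : ∀ n f → sumℤ n f ≡ ℤ∑.sum n f
  sumℤ≡sum zero    f = refl
  sumℤ≡sum (suc n) f = cong (_+ f (suc n)) (sumℤ≡sum n f)

  sumℤ-cong : ∀ n {f g} → (∀ i → f i ≡ g i) → sumℤ n f ≡ sumℤ n g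
  sumℤ-cong n {f} {g} f≡g = begin
    sumℤ n f   ≡⟨ sumℤ≡sum n f ⟩
    ℤ∑.sum n f ≡⟨ ℤ∑.sum-cong n (λ i _ → f≡g i) ⟩
    ℤ∑.sum n g ≡⟨ sumℤ≡sum n g ⟨
    sumℤ n g   ∎

  sumℤ-scaled-cast : ∀ n s (f : ℕ → ℕ) → sumℤ n (λ i → s * + f i) ≡ s * + ℕ∑.sum n f
  sumℤ-scaled-cast zero    s f = refl
  sumℤ-scaled-cast (suc n) s f = trans (cong (_+ s * + f (suc n)) (sumℤ-scaled-cast n s f))
                                       (sym (*-distribˡ-+ s (+ ℕ∑.sum n f) (+ f (suc n))))

  ⊛-suc : ∀ f g n → (f ⊛ g) (suc n) ≡ f 0 * g (suc n) + ((f ∘ suc) ⊛ g) n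
  ⊛-suc f g n = begin
    sumℤ (suc n) h           ≡⟨ sumℤ≡sum (suc n) h ⟩
    ℤ∑.sum (suc n) h         ≡⟨ ℤ∑.sum-cons n h ⟩
    h 0 + ℤ∑.sum n (h ∘ suc) ≡⟨ cong (λ x → h 0 + x) (sumℤ≡sum n (h ∘ suc)) ⟨
    h 0 + sumℤ n (h ∘ suc)   ∎
    where
    h : ℕ → ℤ
    h i = f i * g (suc n ∸ i)

  ⊛-constˡ : ∀ f g n → (∀ i → f (suc i) ≡ 0ℤ) → (f ⊛ g) n ≡ f 0 * g n
  ⊛-constˡ f g zero    _   = refl
  ⊛-constˡ f g (suc n) f≡0 = begin
    (f ⊛ g) (suc n)                     ≡⟨ ⊛-suc f g n ⟩
    f 0 * g (suc n) + ((f ∘ suc) ⊛ g) n ≡⟨ cong (λ x → f 0 * g (suc n) + x) tail≡0 ⟩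
    f 0 * g (suc n) + 0ℤ                ≡⟨ +-identityʳ (f 0 * g (suc n)) ⟩
    f 0 * g (suc n)                     ∎
    where
    tail≡0 : ((f ∘ suc) ⊛ g) n ≡ 0ℤ
    tail≡0 = trans (sumℤ≡sum n _) (ℤ∑.sum-zero n (λ i _ → cong (_* g (n ∸ i)) (f≡0 i)))

  ⊛-linearˡ : ∀ f g n → (∀ i → f (suc (suc i)) ≡ 0ℤ) → (f ⊛ g) (suc n) ≡ f 0 * g (suc n) + f 1 * g n
  ⊛-linearˡ f g n f≡0 = trans (⊛-suc f g n) (cong (λ x → f 0 * g (suc n) + x) (⊛-constˡ (f ∘ suc) g n f≡0))

  ⊛-congˡ : ∀ {f f′} g n → (∀ i → f i ≡ f′ i) → (f ⊛ g) n ≡ (f′ ⊛ g) n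
  ⊛-congˡ g n f≡f′ = sumℤ-cong n (λ i → cong (_* g (n ∸ i)) (f≡f′ i))

  ⊛-scaleˡ : ∀ a f g n → ((a · f) ⊛ g) n ≡ a * (f ⊛ g) n
  ⊛-scaleˡ a f g n = begin
    sumℤ n (λ i → a * f i * g (n ∸ i))       ≡⟨ sumℤ-cong n (λ i → *-assoc a (f i) (g (n ∸ i))) ⟩
    sumℤ n (λ i → a * (f i * g (n ∸ i)))     ≡⟨ sumℤ≡sum n _ ⟩
    ℤ∑.sum n (λ i → a * (f i * g (n ∸ i)))   ≡⟨ ℤ∑.*-distribˡ-sum n a (λ i → f i * g (n ∸ i)) ⟨
    a * ℤ∑.sum n (λ i → f i * g (n ∸ i))     ≡⟨ cong (a *_) (sumℤ≡sum n _) ⟨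
    a * (f ⊛ g) n                            ∎

  coeff-Z^ : ∀ r n → (Z ^P r) n ≡ + shiftedC r 0 n
  coeff-Z^ zero    zero    = refl
  coeff-Z^ zero    (suc n) = refl
  coeff-Z^ (suc r) zero    = refl
  coeff-Z^ (suc r) (suc n) = begin
    (Z ⊛ Z ^P r) (suc n)  ≡⟨ ⊛-linearˡ Z (Z ^P r) n (λ _ → refl) ⟩
    0ℤ + 1ℤ * (Z ^P r) n  ≡⟨ +-identityˡ (1ℤ * (Z ^P r) n) ⟩
    1ℤ * (Z ^P r) n       ≡⟨ *-identityˡ ((Z ^P r) n) ⟩
    (Z ^P r) n            ≡⟨ coeff-Z^ r n ⟩
    + shiftedC r 0 n      ∎

  coeff-[1-Z]^ : ∀ b n → ((const 1ℤ ⊕ ⊖ Z) ^P b) n ≡ -1ℤ ^ n * + (b C n)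
  coeff-[1-Z]^ zero    zero    = refl
  coeff-[1-Z]^ zero    (suc n) = sym (*-zeroʳ (-1ℤ ^ suc n))
  coeff-[1-Z]^ (suc b) zero    = trans (*-identityˡ _) (coeff-[1-Z]^ b 0)
  coeff-[1-Z]^ (suc b) (suc n) = begin
    (Y ⊛ Y ^P b) (suc n)                             ≡⟨ ⊛-linearˡ Y (Y ^P b) n (λ _ → refl) ⟩
    1ℤ * (Y ^P b) (suc n) + -1ℤ * (Y ^P b) n         ≡⟨ cong₂ (λ x y → 1ℤ * x + -1ℤ * y) (coeff-[1-Z]^ b (suc n)) (coeff-[1-Z]^ b n) ⟩
    1ℤ * (-1ℤ ^ suc n * + (b C suc n)) + -1ℤ * (-1ℤ ^ n * + (b C n))
                                                     ≡⟨ collect (-1ℤ ^ n) (+ (b C n)) (+ (b C suc n)) ⟩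
    -1ℤ ^ suc n * (+ (b C n) + + (b C suc n))        ≡⟨ cong (λ x → -1ℤ ^ suc n * + x) (nCk+nC[k+1]≡[n+1]C[k+1] b n) ⟩
    -1ℤ ^ suc n * + (suc b C suc n)                  ∎
    where
    Y : Poly
    Y = const 1ℤ ⊕ ⊖ Z
    collect : ∀ s x y → 1ℤ * (-1ℤ * s * y) + -1ℤ * (s * x) ≡ -1ℤ * s * (x + y)
    collect = solve-∀

  coeff-[-Z]^a⊛[1-Z]^b : ∀ a b n → ((⊖ Z) ^P a ⊛ (const 1ℤ ⊕ ⊖ Z) ^P b) n ≡ -1ℤ ^ n * + shiftedC a b n
  coeff-[-Z]^a⊛[1-Z]^b zero    b n       =
    trans (⊛-constˡ (const 1ℤ) ((const 1ℤ ⊕ ⊖ Z) ^P b) n (λ _ → refl)) (trans (*-identityˡ _) (coeff-[1-Z]^ b n))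
  coeff-[-Z]^a⊛[1-Z]^b (suc a) b zero    = refl
  coeff-[-Z]^a⊛[1-Z]^b (suc a) b (suc n) = begin
    ((⊖ Z) ^P suc a ⊛ Y ^P b) (suc n)                 ≡⟨ ⊛-suc ((⊖ Z) ^P suc a) (Y ^P b) n ⟩
    0ℤ + ((((⊖ Z) ^P suc a) ∘ suc) ⊛ Y ^P b) n        ≡⟨ +-identityˡ _ ⟩
    ((((⊖ Z) ^P suc a) ∘ suc) ⊛ Y ^P b) n             ≡⟨ ⊛-congˡ (Y ^P b) n shift ⟩
    ((-1ℤ · (⊖ Z) ^P a) ⊛ Y ^P b) n                   ≡⟨ ⊛-scaleˡ -1ℤ ((⊖ Z) ^P a) (Y ^P b) n ⟩
    -1ℤ * ((⊖ Z) ^P a ⊛ Y ^P b) n                     ≡⟨ cong (-1ℤ *_) (coeff-[-Z]^a⊛[1-Z]^b a b n) ⟩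
    -1ℤ * (-1ℤ ^ n * + shiftedC a b n)                ≡⟨ *-assoc -1ℤ (-1ℤ ^ n) (+ shiftedC a b n) ⟨
    -1ℤ ^ suc n * + shiftedC a b n                    ∎
    where
    Y : Poly
    Y = const 1ℤ ⊕ ⊖ Z
    shift : ∀ i → ((⊖ Z) ^P suc a) (suc i) ≡ -1ℤ * ((⊖ Z) ^P a) i
    shift i = trans (⊛-linearˡ (⊖ Z) ((⊖ Z) ^P a) i (λ _ → refl)) (+-identityˡ _)

  coeff-LHS : ∀ ℓ n → LHS ℓ n ≡ -1ℤ ^ n * + lhsCoeff ℓ n
  coeff-LHS ℓ n = begin
    LHS ℓ n                                                 ≡⟨ sumℤ-cong ℓ (λ k → sumℤ-cong k (λ j → term k j)) ⟩
    sumℤ ℓ (λ k → sumℤ k (λ j → s * + (c ℓ j k ℕ.* e k j))) ≡⟨ sumℤ-cong ℓ (λ k → sumℤ-scaled-cast k s (λ j → c ℓ j k ℕ.* e k j)) ⟩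
    sumℤ ℓ (λ k → s * + ℕ∑.sum k (λ j → c ℓ j k ℕ.* e k j)) ≡⟨ sumℤ-scaled-cast ℓ s _ ⟩
    s * + lhsCoeff ℓ n                                      ∎
    where
    s : ℤ
    s = -1ℤ ^ n
    e : ℕ → ℕ → ℕ
    e k j = shiftedC (ℓ ∸ k) (k ∸ j) n
    term : ∀ k j → + c ℓ j k * ((⊖ Z) ^P (ℓ ∸ k) ⊛ (const 1ℤ ⊕ ⊖ Z) ^P (k ∸ j)) n ≡ s * + (c ℓ j k ℕ.* e k j)
    term k j = begin
      + c ℓ j k * ((⊖ Z) ^P (ℓ ∸ k) ⊛ (const 1ℤ ⊕ ⊖ Z) ^P (k ∸ j)) n ≡⟨ cong (+ c ℓ j k *_) (coeff-[-Z]^a⊛[1-Z]^b (ℓ ∸ k) (k ∸ j) n) ⟩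
      + c ℓ j k * (s * + e k j)                                      ≡⟨ x*[y*z]≡y*[x*z] (+ c ℓ j k) s (+ e k j) ⟩
      s * (+ c ℓ j k * + e k j)                                      ≡⟨ cong (s *_) (pos-* (c ℓ j k) (e k j)) ⟨
      s * + (c ℓ j k ℕ.* e k j)                                      ∎

  coeff-Z^-diag : ∀ n → (Z ^P n) n ≡ 1ℤ
  coeff-Z^-diag n = trans (coeff-Z^ n n) (cong +_ (trans (shiftedC-≥ {n} 0 ℕₚ.≤-refl) (cong (0 C_) (ℕₚ.n∸n≡0 n))))

  coeff-Z^-< : ∀ {r n} → n < r → (Z ^P r) n ≡ 0ℤ
  coeff-Z^-< {r} {n} n<r = trans (coeff-Z^ r n) (cong +_ (shiftedC-< 0 n<r))

  coeff-Z^-> : ∀ {r n} → r < n → (Z ^P r) n ≡ 0ℤ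
  coeff-Z^-> {r} {n} r<n = trans (coeff-Z^ r n) (cong +_ (shiftedC-> r 0 r<n))

  coeff-monomials-≤ : ∀ (a : ℕ → ℤ) {ℓ n} → n ≤ ℓ → sumP ℓ (λ r → a r · Z ^P r) n ≡ a n
  coeff-monomials-≤ a {ℓ} {n} n≤ℓ = begin
    sumℤ ℓ t         ≡⟨ sumℤ≡sum ℓ t ⟩
    ℤ∑.sum ℓ t       ≡⟨ ℤ∑.sum-extend n≤ℓ (λ r n<r → vanishing r (coeff-Z^-< n<r)) ⟩
    ℤ∑.sum n t       ≡⟨ ℤ∑.sum-last n (λ r r<n → vanishing r (coeff-Z^-> r<n)) ⟩
    a n * (Z ^P n) n ≡⟨ cong (a n *_) (coeff-Z^-diag n) ⟩
    a n * 1ℤ         ≡⟨ *-identityʳ (a n) ⟩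
    a n              ∎
    where
    t : ℕ → ℤ
    t r = a r * (Z ^P r) n
    vanishing : ∀ r → (Z ^P r) n ≡ 0ℤ → t r ≡ 0ℤ
    vanishing r Zʳₙ≡0 = trans (cong (a r *_) Zʳₙ≡0) (*-zeroʳ (a r))

  coeff-monomials-> : ∀ (a : ℕ → ℤ) {ℓ n} → ℓ < n → sumP ℓ (λ r → a r · Z ^P r) n ≡ 0ℤ
  coeff-monomials-> a {ℓ} {n} ℓ<n = trans (sumℤ≡sum ℓ _) (ℤ∑.sum-zero ℓ (λ r r≤ℓ →
    trans (cong (a r *_) (coeff-Z^-> (ℕₚ.≤-<-trans r≤ℓ ℓ<n))) (*-zeroʳ (a r))))

  rhsCoeff : ℕ → ℕ → ℤ
  rhsCoeff ℓ r = -1ℤ ^ r * + (2 ℕ.^ (2 ℕ.* ℓ ∸ 2 ℕ.* r)) * + d ℓ r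

  LHS≡RHS-≤ : ∀ m p → LHS (m ℕ.+ p) p ≡ RHS (m ℕ.+ p) p
  LHS≡RHS-≤ m p = begin
    LHS ℓ p                                        ≡⟨ coeff-LHS ℓ p ⟩
    -1ℤ ^ p * + lhsCoeff ℓ p                       ≡⟨ cong (λ x → -1ℤ ^ p * + x) (lhsCoeff-closedForm m p) ⟩
    -1ℤ ^ p * + (4 ℕ.^ m ℕ.* d ℓ p)                ≡⟨ cong (λ x → -1ℤ ^ p * + (x ℕ.* d ℓ p)) 4^m≡2^[2ℓ∸2p] ⟩
    -1ℤ ^ p * + (2^[2ℓ∸2p] ℕ.* d ℓ p)              ≡⟨ cong (-1ℤ ^ p *_) (pos-* 2^[2ℓ∸2p] (d ℓ p)) ⟩
    -1ℤ ^ p * (+ 2^[2ℓ∸2p] * + d ℓ p)              ≡⟨ *-assoc (-1ℤ ^ p) (+ 2^[2ℓ∸2p]) (+ d ℓ p) ⟨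
    -1ℤ ^ p * + 2^[2ℓ∸2p] * + d ℓ p                ≡⟨ coeff-monomials-≤ (rhsCoeff ℓ) (ℕₚ.m≤n+m p m) ⟨
    RHS ℓ p                                        ∎
    where
    ℓ 2^[2ℓ∸2p] : ℕ
    ℓ = m ℕ.+ p
    2^[2ℓ∸2p] = 2 ℕ.^ (2 ℕ.* ℓ ∸ 2 ℕ.* p)
    4^m≡2^[2ℓ∸2p] : 4 ℕ.^ m ≡ 2^[2ℓ∸2p]
    4^m≡2^[2ℓ∸2p] = trans (ℕₚ.^-*-assoc 2 2 m)
      (cong (2 ℕ.^_) (trans (cong (2 ℕ.*_) (sym (ℕₚ.m+n∸n≡m m p))) (ℕₚ.*-distribˡ-∸ 2 ℓ p)))

  LHS≡RHS-> : ∀ {ℓ n} → ℓ < n → LHS ℓ n ≡ RHS ℓ n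
  LHS≡RHS-> {ℓ} {n} ℓ<n = begin
    LHS ℓ n                   ≡⟨ coeff-LHS ℓ n ⟩
    -1ℤ ^ n * + lhsCoeff ℓ n  ≡⟨ cong (λ x → -1ℤ ^ n * + x) (lhsCoeff-vanish ℓ<n) ⟩
    -1ℤ ^ n * 0ℤ              ≡⟨ *-zeroʳ (-1ℤ ^ n) ⟩
    0ℤ                        ≡⟨ coeff-monomials-> (rhsCoeff ℓ) ℓ<n ⟨
    RHS ℓ n                   ∎

proposition4p14 : (ℓ : ℕ) → LHS ℓ ≈P RHS ℓ
proposition4p14 ℓ n with n ≤? ℓ
... | yes n≤ℓ = subst (λ ℓ → LHS ℓ n ≡ RHS ℓ n) (m∸n+n≡m n≤ℓ) (LHS≡RHS-≤ (ℓ ∸ n) n)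
... | no  n≰ℓ = LHS≡RHS-> (≰⇒> n≰ℓ)
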